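{- Let $N=(V,E)$ be a network having a connected component $G_1$ whose vertex set is $A\cup B$, where $A\cap B=\emptyset$, $|A|=|B|=n>5$, each of $A$ and $B$ induces a clique, and $G_1$ has exactly one edge between $A$ and $B$ (and no other edges). Then in every modularity-optimal clustering of $N$, either $A\cup B$ is a single cluster, or $A$ and $B$ are both clusters.
   Context: A network is a finite simple undirected unweighted graph; a clustering is a partition of the vertex set into nonempty clusters. For Modularity only clusterings whose clusters each induce a connected subgraph are admissible. The Modularity score of a clustering $\mathcal{C}$ of $N=(V,E)$ is $\sum_{c\in\mathcal{C}}\left[\frac{e_c}{|E|}-\left(\frac{d_c}{2|E|}\right)^2\right]$, where $e_c$ is the number of edges with both endpoints in $c$ and $d_c$ is the sum of the degrees in $N$ of the vertices in $c$. A modularity-optimal clustering is an admissible clustering of maximum Modularity score. -}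

module Defs where

open import Data.Nat as ℕ using (ℕ; zero; suc)
open import Data.Integer as ℤ using (ℤ; +_)
open import Data.Rational as ℚ using (ℚ; 0ℚ)
open import Data.Bool using (Bool; true; false; _∧_; if_then_else_)
open import Data.Fin using (Fin; _<?_; _≟_)
open import Data.Fin.Subset using (Subset; _∈_; _∉_; _∪_; Nonempty)
open import Data.List using (List; []; _∷_; map; foldr; allFin; concatMap)
open import Data.Product using (Σ; ∃; _×_; _,_)
open import Relation.Nullary using (¬_; does)
open import Relation.Binary.PropositionalEquality using (_≡_)

record Network (k : ℕ) : Set where
  field
    adj    : Fin k → Fin k → Bool
    sym    : ∀ i j → adj i j ≡ adj j i
    irrefl : ∀ i → adj i i ≡ false
open Network public

Adj : ∀ {k} → Network k → Fin k → Fin k → Set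
Adj N u v = adj N u v ≡ true

-- A clustering is encoded by a labelling Fin k → Fin k; the clusters are the
-- nonempty fibres (every partition of Fin k arises this way).
Clustering : ℕ → Set
Clustering k = Fin k → Fin k

countL : ∀ {A : Set} → (A → Bool) → List A → ℕ
countL p = foldr (λ x n → if p x then suc n else n) 0

pairs : ∀ k → List (Fin k × Fin k)
pairs k = concatMap (λ i → map (λ j → (i , j)) (allFin k)) (allFin k)

lt : ∀ {k} → Fin k → Fin k → Bool
lt i j = does (i <? j)

eqF : ∀ {k} → Fin k → Fin k → Bool
eqF i j = does (i ≟ j)

numEdges : ∀ {k} → Network k → ℕ
numEdges {k} N = countL (λ { (i , j) → lt i j ∧ adj N i j }) (pairs k)

degree : ∀ {k} → Network k → Fin k → ℕ
degree {k} N v = countL (adj N v) (allFin k)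

innerEdges : ∀ {k} → Network k → Clustering k → Fin k → ℕ
innerEdges {k} N cl c =
  countL (λ { (i , j) → lt i j ∧ adj N i j ∧ eqF (cl i) c ∧ eqF (cl j) c }) (pairs k)

clusterDegree : ∀ {k} → Network k → Clustering k → Fin k → ℕ
clusterDegree {k} N cl c =
  foldr (λ v s → if eqF (cl v) c then degree N v ℕ.+ s else s) 0 (allFin k)

-- Modularity score; empty labels contribute 0 (e_c = d_c = 0).
-- (For an edgeless network we set the score to 0; irrelevant below.)
modularity : ∀ {k} → Network k → Clustering k → ℚ
modularity {k} N cl with numEdges N
... | zero  = 0ℚ
... | suc m = foldr (λ c s → term c ℚ.+ s) 0ℚ (allFin k)
  where
    term : Fin k → ℚ
    term c = ((+ innerEdges N cl c) ℚ./ suc m)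
             ℚ.- ((+ clusterDegree N cl c) ℚ./ (2 ℕ.* suc m)) ℚ.* ((+ clusterDegree N cl c) ℚ./ (2 ℕ.* suc m))

data PathIn {k} (N : Network k) (cl : Clustering k) (c : Fin k) : Fin k → Fin k → Set where
  here : ∀ {u} → cl u ≡ c → PathIn N cl c u u
  step : ∀ {u w v} → cl u ≡ c → Adj N u w → PathIn N cl c w v → PathIn N cl c u v

Admissible : ∀ {k} → Network k → Clustering k → Set
Admissible N cl = ∀ u v → cl u ≡ cl v → PathIn N cl (cl u) u v

ModularityOptimal : ∀ {k} → Network k → Clustering k → Set
ModularityOptimal N cl =
  Admissible N cl × (∀ cl′ → Admissible N cl′ → modularity N cl′ ℚ.≤ modularity N cl)

IsCluster : ∀ {k} → Clustering k → Subset k → Set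
IsCluster cl S = Nonempty S × ∃ λ c → ∀ v → (cl v ≡ c → v ∈ S) × (v ∈ S → cl v ≡ c)

Clique : ∀ {k} → Network k → Subset k → Set
Clique N S = ∀ u v → u ∈ S → v ∈ S → ¬ u ≡ v → Adj N u v

-- Scaling by 4|E|², the modularity of a clustering becomes the integer score
-- Σ_{i,j} [cl i = cl j] (2|E| A_ij − d_i d_j).  In the component every vertex has degree n − 1, except the
-- bridge ends a and b, which have degree n; as 2|E| > n², the weight of a pair of the component is positive
-- exactly when the pair is an edge.
-- Suppose an optimal clustering separates some u ∈ A from a.  Relabel A and B as two whole clusters, reusing
-- labels whose clusters lie inside A ∪ B (clusters are connected, so they cannot leave the component).  Every
-- pair then scores at least as much as before, except the bridge {a, b} when a and b were together, while the
-- edge {u, a} newly contributes twice 2|E| − d_u d_a.  If a and b were apart this is a strict improvement;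
-- otherwise the net change is at least 2 d_a (d_b − d_u) = 2n > 0.  So A, and symmetrically B, lies inside a
-- single cluster, which is then A, B or A ∪ B.  The argument only needs n > 2.
module Submission where

open import Defs hiding (sym)
open import Data.Nat using (ℕ; _<_)
open import Data.Fin using (Fin)
open import Data.Fin.Subset using (Subset; _∈_; _∉_; _∪_; ∣_∣)
open import Data.Product using (Σ; ∃; _×_; _,_)
open import Data.Sum using (_⊎_)
open import Relation.Nullary using (¬_)
open import Relation.Binary.PropositionalEquality using (_≡_)

open import Data.Bool using (Bool; true; false; _∧_; if_then_else_)
open import Data.Empty using (⊥-elim)
open import Data.Fin using (zero; suc; _≟_; _<?_)
import Data.Fin.Properties as FinP
open import Data.Fin.Subset using (inside; outside)
open import Data.Fin.Subset.Properties using (_∈?_; x∈p∪q⁺; x∈p∪q⁻)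
open import Data.Integer as ℤ using (ℤ; +_; 0ℤ; 1ℤ; _+_; _-_; _*_; -_; _≤_)
import Data.Integer.Properties as ℤP
open import Data.Integer.Tactic.RingSolver using (solve-∀)
open import Data.List using (List; []; _∷_; _++_; map; foldr; tabulate; allFin; concatMap)
import Data.List.Properties as ListP
import Data.Nat as ℕ
open import Data.Nat using (zero; suc)
import Data.Nat.Properties as ℕP
open import Data.Product using (proj₁; proj₂; swap)
open import Data.Rational as ℚ using (ℚ; 0ℚ)
import Data.Rational.Properties as ℚP
open import Data.Rational.Unnormalised as ℚᵘ using (ℚᵘ; mkℚᵘ; _≃_; *≡*; *≤*)
import Data.Rational.Unnormalised.Properties as ℚᵘP
open import Data.Sum using (inj₁; inj₂; [_,_])
import Data.Sum as Sum
open import Data.Vec using ([]; _∷_)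
open import Function using (_∘_; id)
open import Relation.Binary.Definitions using (tri<; tri≈; tri>)
open import Relation.Binary.PropositionalEquality
  using (refl; sym; trans; cong; cong₂; subst; subst₂; ≢-sym; module ≡-Reasoning)
open import Relation.Nullary using (does; yes; no)
open import Relation.Nullary.Decidable using (dec-true; dec-false; _×-dec_)
open import Algebra.Properties.Semiring.Sum ℤP.+-*-semiring
  using (sum; sum-syntax; sum-cong-≗; ∑-distrib-+; ∑-comm; *-distribˡ-sum; *-distribʳ-sum; sum-replicate-zero)

-- Iverson brackets and finite sums

𝟙 : Bool → ℤ
𝟙 true  = 1ℤ
𝟙 false = 0ℤ

𝟙-∧ : ∀ p q → 𝟙 (p ∧ q) ≡ 𝟙 p * 𝟙 q
𝟙-∧ true  q = sym (ℤP.*-identityˡ (𝟙 q))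
𝟙-∧ false q = refl

𝟙-*-nonneg : ∀ p {x} → 0ℤ ≤ x → 0ℤ ≤ 𝟙 p * x
𝟙-*-nonneg true  {x} 0≤x = subst (0ℤ ≤_) (sym (ℤP.*-identityˡ x)) 0≤x
𝟙-*-nonneg false     _   = ℤP.≤-refl

eqF-refl : ∀ {k} (x : Fin k) → eqF x x ≡ true
eqF-refl x = dec-true (x ≟ x) refl

eqF-≢ : ∀ {k} {x y : Fin k} → ¬ x ≡ y → eqF x y ≡ false
eqF-≢ {x = x} {y} = dec-false (x ≟ y)

eqF-sym : ∀ {k} (x y : Fin k) → eqF x y ≡ eqF y x
eqF-sym x y with x ≟ y
... | yes refl = sym (eqF-refl x)
... | no  x≢y  = sym (eqF-≢ (≢-sym x≢y))

𝟙-eqF-refl-* : ∀ {k} (x : Fin k) z → 𝟙 (eqF x x) * z ≡ z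
𝟙-eqF-refl-* x z = trans (cong (λ b → 𝟙 b * z) (eqF-refl x)) (ℤP.*-identityˡ z)

𝟙-eqF-≢-* : ∀ {k} {x y : Fin k} → ¬ x ≡ y → ∀ z → 𝟙 (eqF x y) * z ≡ 0ℤ
𝟙-eqF-≢-* x≢y z = cong (λ b → 𝟙 b * z) (eqF-≢ x≢y)

i<j⇒0<j-i : ∀ {i j} → i ℤ.< j → 0ℤ ℤ.< j - i
i<j⇒0<j-i {i} {j} i<j = subst (ℤ._< j - i) (ℤP.+-inverseʳ i) (ℤP.+-monoˡ-< (- i) i<j)

+-cancelʳ-≤ : ∀ {x y} z → x + z ≤ y + z → x ≤ y
+-cancelʳ-≤ {x} {y} z x+z≤y+z = subst₂ _≤_ (cancel x z) (cancel y z) (ℤP.+-monoˡ-≤ (- z) x+z≤y+z)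
  where
  cancel : ∀ x z → x + z - z ≡ x
  cancel = solve-∀

square<double-pred : ∀ n → 2 < n → + n * + n ℤ.< (+ n + + n) * + ℕ.pred n
square<double-pred (suc zero)          (ℕ.s≤s ())
square<double-pred (suc (suc zero))    (ℕ.s≤s (ℕ.s≤s ()))
square<double-pred (suc (suc (suc p))) _ =
  subst (n′ * n′ ℤ.<_) (sym (expand (+ p)))
    (subst (ℤ._< n′ * n′ + n′ * (+ 1 + + p)) (ℤP.+-identityʳ (n′ * n′))
           (ℤP.+-monoʳ-< (n′ * n′) (ℤ.+<+ (ℕ.s≤s ℕ.z≤n))))
  where
  n′ : ℤ
  n′ = + 3 + + p
  expand : ∀ q → (+ 3 + q + (+ 3 + q)) * (+ 2 + q) ≡ (+ 3 + q) * (+ 3 + q) + (+ 3 + q) * (+ 1 + q)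
  expand = solve-∀

∑-mono-≤ : ∀ {n} {f g : Fin n → ℤ} → (∀ i → f i ≤ g i) → sum f ≤ sum g
∑-mono-≤ {zero}  f≤g = ℤP.≤-refl
∑-mono-≤ {suc n} f≤g = ℤP.+-mono-≤ (f≤g zero) (∑-mono-≤ (f≤g ∘ suc))

∑-nonneg : ∀ {n} {f : Fin n → ℤ} → (∀ i → 0ℤ ≤ f i) → 0ℤ ≤ sum f
∑-nonneg {n} {f} 0≤f = subst (_≤ sum f) (sum-replicate-zero n) (∑-mono-≤ 0≤f)

∑-single-≤ : ∀ {n} {f : Fin n → ℤ} → (∀ i → 0ℤ ≤ f i) → ∀ x → f x ≤ sum f
∑-single-≤ {suc n} 0≤f zero    = ℤP.i≤i+j _ _ {{ℤ.nonNegative (∑-nonneg (0≤f ∘ suc))}}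
∑-single-≤ {suc n} 0≤f (suc x) =
  ℤP.≤-trans (∑-single-≤ (0≤f ∘ suc) x) (ℤP.i≤j+i _ _ {{ℤ.nonNegative (0≤f zero)}})

∑-pair-≤ : ∀ {n} {f : Fin n → ℤ} → (∀ i → 0ℤ ≤ f i) → ∀ {x y} → ¬ x ≡ y → f x + f y ≤ sum f
∑-pair-≤ {suc n}     0≤f {zero}  {zero}  0≢0 = ⊥-elim (0≢0 refl)
∑-pair-≤ {suc n} {f} 0≤f {zero}  {suc y} _   = ℤP.+-monoʳ-≤ (f zero) (∑-single-≤ (0≤f ∘ suc) y)
∑-pair-≤ {suc n} {f} 0≤f {suc x} {zero}  _   =
  subst (_≤ sum f) (ℤP.+-comm (f zero) (f (suc x))) (ℤP.+-monoʳ-≤ (f zero) (∑-single-≤ (0≤f ∘ suc) x))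
∑-pair-≤ {suc n} {f} 0≤f {suc x} {suc y} x≢y =
  ℤP.≤-trans (∑-pair-≤ (0≤f ∘ suc) (x≢y ∘ cong suc)) (ℤP.i≤j+i _ _ {{ℤ.nonNegative (0≤f zero)}})

∑-distrib-− : ∀ {n} (f g : Fin n → ℤ) → ∑[ i < n ] (f i - g i) ≡ sum f - sum g
∑-distrib-− {zero}  f g = refl
∑-distrib-− {suc n} f g =
  trans (cong (λ s → f zero - g zero + s) (∑-distrib-− (f ∘ suc) (g ∘ suc)))
        (interchange (f zero) (g zero) (sum (f ∘ suc)) (sum (g ∘ suc)))
  where
  interchange : ∀ a b c d → a - b + (c - d) ≡ a + c - (b + d)
  interchange = solve-∀

∑-select : ∀ {n} (x : Fin n) (f : Fin n → ℤ) → ∑[ i < n ] (𝟙 (eqF x i) * f i) ≡ f x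
∑-select {suc n} zero    f = begin
  1ℤ * f zero + ∑[ i < n ] (0ℤ * f (suc i))  ≡⟨ cong₂ _+_ (ℤP.*-identityˡ (f zero)) (sum-replicate-zero n) ⟩
  f zero + 0ℤ                                ≡⟨ ℤP.+-identityʳ (f zero) ⟩
  f zero                                     ∎
  where open ≡-Reasoning
∑-select {suc n} (suc x) f = trans (ℤP.+-identityˡ _) (∑-select x (f ∘ suc))

∑-𝟙-eqF : ∀ {n} (x : Fin n) → ∑[ i < n ] 𝟙 (eqF x i) ≡ 1ℤ
∑-𝟙-eqF x = trans (sum-cong-≗ (λ i → sym (ℤP.*-identityʳ (𝟙 (eqF x i))))) (∑-select x (λ _ → 1ℤ))

∑-*-∑ : ∀ {m n} (f : Fin m → ℤ) (g : Fin n → ℤ) → sum f * sum g ≡ ∑[ i < m ] ∑[ j < n ] (f i * g j)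
∑-*-∑ f g = trans (*-distribʳ-sum (sum g) f) (sum-cong-≗ (λ i → *-distribˡ-sum (f i) g))

∑∑-cong : ∀ {m n} {f g : Fin m → Fin n → ℤ} → (∀ i j → f i j ≡ g i j) →
          ∑[ i < m ] ∑[ j < n ] f i j ≡ ∑[ i < m ] ∑[ j < n ] g i j
∑∑-cong f≡g = sum-cong-≗ (λ i → sum-cong-≗ (f≡g i))

∑∑-distrib-+ : ∀ {m n} (f g : Fin m → Fin n → ℤ) →
  ∑[ i < m ] ∑[ j < n ] (f i j + g i j) ≡ ∑[ i < m ] ∑[ j < n ] f i j + ∑[ i < m ] ∑[ j < n ] g i j
∑∑-distrib-+ f g =
  trans (sum-cong-≗ (λ i → ∑-distrib-+ (f i) (g i))) (∑-distrib-+ (λ i → sum (f i)) (λ i → sum (g i)))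

∑∑-distrib-− : ∀ {m n} (f g : Fin m → Fin n → ℤ) →
  ∑[ i < m ] ∑[ j < n ] (f i j - g i j) ≡ ∑[ i < m ] ∑[ j < n ] f i j - ∑[ i < m ] ∑[ j < n ] g i j
∑∑-distrib-− f g =
  trans (sum-cong-≗ (λ i → ∑-distrib-− (f i) (g i))) (∑-distrib-− (λ i → sum (f i)) (λ i → sum (g i)))

*-distribˡ-∑∑ : ∀ {m n} x (f : Fin m → Fin n → ℤ) →
                x * ∑[ i < m ] ∑[ j < n ] f i j ≡ ∑[ i < m ] ∑[ j < n ] (x * f i j)
*-distribˡ-∑∑ x f = trans (*-distribˡ-sum x (λ i → sum (f i))) (sum-cong-≗ (λ i → *-distribˡ-sum x (f i)))

∑-push-in : ∀ {l m n} (F : Fin l → Fin m → Fin n → ℤ) →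
            ∑[ c < l ] ∑[ i < m ] ∑[ j < n ] F c i j ≡ ∑[ i < m ] ∑[ j < n ] ∑[ c < l ] F c i j
∑-push-in {n = n} F = trans (∑-comm (λ c i → ∑[ j < n ] F c i j)) (sum-cong-≗ (λ i → ∑-comm (λ c → F c i)))

∑∑-select : ∀ {m n} (x : Fin m) (y : Fin n) (f : Fin m → Fin n → ℤ) →
            ∑[ i < m ] ∑[ j < n ] (𝟙 (eqF x i) * (𝟙 (eqF y j) * f i j)) ≡ f x y
∑∑-select x y f = trans (sum-cong-≗ row) (∑-select x (λ i → f i y))
  where
  row : ∀ i → ∑[ j < _ ] (𝟙 (eqF x i) * (𝟙 (eqF y j) * f i j)) ≡ 𝟙 (eqF x i) * f i y
  row i = trans (sym (*-distribˡ-sum (𝟙 (eqF x i)) (λ j → 𝟙 (eqF y j) * f i j)))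
                (cong (𝟙 (eqF x i) *_) (∑-select y (f i)))

∑∑-pair-≤ : ∀ {m n} {f : Fin m → Fin n → ℤ} → (∀ i j → 0ℤ ≤ f i j) →
            ∀ {x₁ x₂} y₁ y₂ → ¬ x₁ ≡ x₂ → f x₁ y₁ + f x₂ y₂ ≤ ∑[ i < m ] ∑[ j < n ] f i j
∑∑-pair-≤ 0≤f y₁ y₂ x₁≢x₂ =
  ℤP.≤-trans (ℤP.+-mono-≤ (∑-single-≤ (0≤f _) y₁) (∑-single-≤ (0≤f _) y₂))
             (∑-pair-≤ (λ i → ∑-nonneg (0≤f i)) x₁≢x₂)

-- Counting as summation

countL-++ : ∀ {A : Set} (p : A → Bool) xs ys → countL p (xs ++ ys) ≡ countL p xs ℕ.+ countL p ys
countL-++ p []       ys = refl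
countL-++ p (x ∷ xs) ys with p x
... | true  = cong suc (countL-++ p xs ys)
... | false = countL-++ p xs ys

weightedCount-tabulate : ∀ {A : Set} {n} (p : A → Bool) (w : A → ℕ) (f : Fin n → A) →
  + foldr (λ v s → if p v then w v ℕ.+ s else s) 0 (tabulate f) ≡ ∑[ i < n ] (𝟙 (p (f i)) * + w (f i))
weightedCount-tabulate {n = zero}  p w f = refl
weightedCount-tabulate {n = suc n} p w f with p (f zero)
... | true  = trans (ℤP.pos-+ (w (f zero)) _)
                    (cong₂ _+_ (sym (ℤP.*-identityˡ (+ w (f zero)))) (weightedCount-tabulate p w (f ∘ suc)))
... | false = trans (weightedCount-tabulate p w (f ∘ suc)) (sym (ℤP.+-identityˡ _))

countL-tabulate : ∀ {A : Set} {n} (p : A → Bool) (f : Fin n → A) →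
                  + countL p (tabulate f) ≡ ∑[ i < n ] 𝟙 (p (f i))
countL-tabulate p f =
  trans (weightedCount-tabulate p (λ _ → 1) f) (sum-cong-≗ (λ i → ℤP.*-identityʳ (𝟙 (p (f i)))))

countL-pairs : ∀ {k} (p : Fin k × Fin k → Bool) → + countL p (pairs k) ≡ ∑[ i < k ] ∑[ j < k ] 𝟙 (p (i , j))
countL-pairs {k} p = trans (rows id) (sum-cong-≗ row)
  where
  row-list : Fin k → List (Fin k × Fin k)
  row-list i = map (i ,_) (allFin k)
  rows : ∀ {n} (f : Fin n → Fin k) →
         + countL p (concatMap row-list (tabulate f)) ≡ ∑[ i < n ] (+ countL p (row-list (f i)))
  rows {zero}  f = refl
  rows {suc n} f = begin
    + countL p (row-list (f zero) ++ concatMap row-list (tabulate (f ∘ suc)))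
      ≡⟨ cong +_ (countL-++ p (row-list (f zero)) (concatMap row-list (tabulate (f ∘ suc)))) ⟩
    + (countL p (row-list (f zero)) ℕ.+ countL p (concatMap row-list (tabulate (f ∘ suc))))
      ≡⟨ ℤP.pos-+ (countL p (row-list (f zero))) _ ⟩
    + countL p (row-list (f zero)) + + countL p (concatMap row-list (tabulate (f ∘ suc)))
      ≡⟨ cong (λ s → + countL p (row-list (f zero)) + s) (rows (f ∘ suc)) ⟩
    ∑[ i < suc n ] (+ countL p (row-list (f i))) ∎
    where open ≡-Reasoning
  row : ∀ i → + countL p (row-list i) ≡ ∑[ j < k ] 𝟙 (p (i , j))
  row i = trans (cong (+_ ∘ countL p) (ListP.map-tabulate id (i ,_))) (countL-tabulate p (i ,_))

∑-∈ : ∀ {k} (A : Subset k) → ∑[ j < k ] 𝟙 (does (j ∈? A)) ≡ + ∣ A ∣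
∑-∈ []            = refl
∑-∈ (inside  ∷ A) = cong (λ s → 1ℤ + s) (∑-∈ A)
∑-∈ (outside ∷ A) = trans (ℤP.+-identityˡ _) (∑-∈ A)

𝟙-lt-split : ∀ {k} {i j : Fin k} → ¬ i ≡ j → 𝟙 (lt i j) + 𝟙 (lt j i) ≡ 1ℤ
𝟙-lt-split {i = i} {j} i≢j with FinP.<-cmp i j
... | tri< i<j _ j≮i = cong₂ (λ p q → 𝟙 p + 𝟙 q) (dec-true (i <? j) i<j) (dec-false (j <? i) j≮i)
... | tri≈ _ i≡j _   = ⊥-elim (i≢j i≡j)
... | tri> i≮j _ j<i = cong₂ (λ p q → 𝟙 p + 𝟙 q) (dec-false (i <? j) i≮j) (dec-true (j <? i) j<i)

∑∑-upper-half : ∀ {k} (P : Fin k → Fin k → ℤ) → (∀ i j → P i j ≡ P j i) → (∀ i → P i i ≡ 0ℤ) →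
                + 2 * ∑[ i < k ] ∑[ j < k ] (𝟙 (lt i j) * P i j) ≡ ∑[ i < k ] ∑[ j < k ] P i j
∑∑-upper-half {k} P P-sym P-diag = begin
  + 2 * S
    ≡⟨ double S ⟩
  S + S
    ≡⟨ cong (λ x → S + x) (∑-comm (λ i j → 𝟙 (lt i j) * P i j)) ⟩
  S + ∑[ i < k ] ∑[ j < k ] (𝟙 (lt j i) * P j i)
    ≡⟨ cong (λ x → S + x) (∑∑-cong (λ i j → cong (𝟙 (lt j i) *_) (P-sym j i))) ⟩
  S + ∑[ i < k ] ∑[ j < k ] (𝟙 (lt j i) * P i j)
    ≡⟨ ∑∑-distrib-+ (λ i j → 𝟙 (lt i j) * P i j) (λ i j → 𝟙 (lt j i) * P i j) ⟨
  ∑[ i < k ] ∑[ j < k ] (𝟙 (lt i j) * P i j + 𝟙 (lt j i) * P i j)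
    ≡⟨ ∑∑-cong split ⟨
  ∑[ i < k ] ∑[ j < k ] P i j ∎
  where
  open ≡-Reasoning
  S : ℤ
  S = ∑[ i < k ] ∑[ j < k ] (𝟙 (lt i j) * P i j)
  double : ∀ x → + 2 * x ≡ x + x
  double = solve-∀
  split : ∀ i j → P i j ≡ 𝟙 (lt i j) * P i j + 𝟙 (lt j i) * P i j
  split i j with i ≟ j
  ... | yes refl rewrite P-diag i | dec-false (i <? i) (FinP.<-irrefl refl) = refl
  ... | no  i≢j  = begin
    P i j                                    ≡⟨ ℤP.*-identityˡ (P i j) ⟨
    1ℤ * P i j                               ≡⟨ cong (_* P i j) (𝟙-lt-split i≢j) ⟨
    (𝟙 (lt i j) + 𝟙 (lt j i)) * P i j        ≡⟨ ℤP.*-distribʳ-+ (P i j) (𝟙 (lt i j)) (𝟙 (lt j i)) ⟩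
    𝟙 (lt i j) * P i j + 𝟙 (lt j i) * P i j  ∎

together : ∀ {k} → Clustering k → Fin k → Fin k → Bool
together cl i j = eqF (cl i) (cl j)

together-sym : ∀ {k} (cl : Clustering k) i j → together cl i j ≡ together cl j i
together-sym cl i j = eqF-sym (cl i) (cl j)

together-true : ∀ {k} (cl : Clustering k) {i j} → cl i ≡ cl j → together cl i j ≡ true
together-true cl {i} {j} = dec-true (cl i ≟ cl j)

together-false : ∀ {k} (cl : Clustering k) {i j} → ¬ cl i ≡ cl j → together cl i j ≡ false
together-false cl {i} {j} = dec-false (cl i ≟ cl j)

change-nonneg : ∀ {k} (cl′ cl : Clustering k) i j {w} →
                (cl′ i ≡ cl′ j → ¬ cl i ≡ cl j → 0ℤ ≤ w) → (¬ cl′ i ≡ cl′ j → cl i ≡ cl j → w ≤ 0ℤ) →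
                0ℤ ≤ (𝟙 (together cl′ i j) - 𝟙 (together cl i j)) * w
change-nonneg cl′ cl i j {w} joined separated with cl′ i ≟ cl′ j | cl i ≟ cl j
... | yes _  | yes _ = ℤP.≤-refl
... | yes e′ | no ¬e = subst (0ℤ ≤_) (sym (ℤP.*-identityˡ w)) (joined e′ ¬e)
... | no ¬e′ | yes e = subst (0ℤ ≤_) (sym (ℤP.-1*i≡-i w)) (ℤP.neg-mono-≤ (separated ¬e′ e))
... | no _   | no _  = ℤP.≤-refl

module _ {k} {N : Network k} where

  PathIn-stays : ∀ {cl : Clustering k} (U : Fin k → Set) → (∀ {u v} → U u → Adj N u v → U v) →
                 ∀ {c u v} → PathIn N cl c u v → U u → U v
  PathIn-stays U closed (here _)         Uu = Uu
  PathIn-stays U closed (step _ u~w w⇝v) Uu = PathIn-stays U closed w⇝v (closed Uu u~w)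

  PathIn-relabel : ∀ {cl cl′ : Clustering k} (W : Fin k → Set) → (∀ {u v} → W u → Adj N u v → W v) →
                   (∀ {w} → W w → cl′ w ≡ cl w) → ∀ {c u v} → PathIn N cl c u v → W u → PathIn N cl′ c u v
  PathIn-relabel W closed agree (here cl-u)         Wu = here (trans (agree Wu) cl-u)
  PathIn-relabel W closed agree (step cl-u u~w w⇝v) Wu =
    step (trans (agree Wu) cl-u) u~w (PathIn-relabel W closed agree w⇝v (closed Wu u~w))

  clique-PathIn : ∀ (cl : Clustering k) {S} → Clique N S → ∀ {u v} → u ∈ S → v ∈ S → cl u ≡ cl v →
                  PathIn N cl (cl u) u v
  clique-PathIn cl S-clique {u} {v} u∈S v∈S cl-uv with u ≟ v
  ... | yes refl = here refl
  ... | no  u≢v  = step refl (S-clique u v u∈S v∈S u≢v) (here (sym cl-uv))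

-- Modularity as an integer score

adj-false : ∀ {k} (N : Network k) {u v} → ¬ Adj N u v → adj N u v ≡ false
adj-false N {u} {v} ¬u~v with adj N u v
... | true  = ⊥-elim (¬u~v refl)
... | false = refl

module _ {k} (N : Network k) where

  degree-∑ : ∀ i → + degree N i ≡ ∑[ j < k ] 𝟙 (adj N i j)
  degree-∑ i = countL-tabulate (adj N i) id

  handshake : + 2 * + numEdges N ≡ ∑[ i < k ] (+ degree N i)
  handshake = begin
    + 2 * + numEdges N
      ≡⟨ cong (+ 2 *_) (countL-pairs (λ (i , j) → lt i j ∧ adj N i j)) ⟩
    + 2 * ∑[ i < k ] ∑[ j < k ] 𝟙 (lt i j ∧ adj N i j)
      ≡⟨ cong (+ 2 *_) (∑∑-cong (λ i j → 𝟙-∧ (lt i j) (adj N i j))) ⟩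
    + 2 * ∑[ i < k ] ∑[ j < k ] (𝟙 (lt i j) * 𝟙 (adj N i j))
      ≡⟨ ∑∑-upper-half (λ i j → 𝟙 (adj N i j)) (λ i j → cong 𝟙 (Network.sym N i j)) (λ i → cong 𝟙 (irrefl N i)) ⟩
    ∑[ i < k ] ∑[ j < k ] 𝟙 (adj N i j)
      ≡⟨ sum-cong-≗ degree-∑ ⟨
    ∑[ i < k ] (+ degree N i) ∎
    where open ≡-Reasoning

  -- 2|E| times the modularity matrix A_ij − d_i d_j / 2|E|; the score is 4|E|² times the modularity.
  modMatrix : Fin k → Fin k → ℤ
  modMatrix i j = + 2 * + numEdges N * 𝟙 (adj N i j) - + degree N i * + degree N j

  score : Clustering k → ℤ
  score cl = ∑[ i < k ] ∑[ j < k ] (𝟙 (together cl i j) * modMatrix i j)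

  modMatrix-sym : ∀ i j → modMatrix i j ≡ modMatrix j i
  modMatrix-sym i j = cong₂ (λ A dd → + 2 * + numEdges N * 𝟙 A - dd)
                            (Network.sym N i j) (ℤP.*-comm (+ degree N i) (+ degree N j))

  modMatrix-adj : ∀ {i j} → Adj N i j → modMatrix i j ≡ + 2 * + numEdges N - + degree N i * + degree N j
  modMatrix-adj {i} {j} i~j rewrite i~j =
    cong (_- + degree N i * + degree N j) (ℤP.*-identityʳ (+ 2 * + numEdges N))

  modMatrix-pos : ∀ {i j} → Adj N i j → + degree N i * + degree N j ℤ.< + 2 * + numEdges N →
                  0ℤ ℤ.< modMatrix i j
  modMatrix-pos i~j dd<2E rewrite modMatrix-adj i~j = i<j⇒0<j-i dd<2E

  modMatrix-nonpos : ∀ {i j} → ¬ Adj N i j → modMatrix i j ≤ 0ℤ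
  modMatrix-nonpos {i} {j} i≁j rewrite adj-false N i≁j | ℤP.*-zeroʳ (+ 2 * + numEdges N) =
    subst (_≤ 0ℤ) (sym (ℤP.+-identityˡ _))
      (ℤP.neg-mono-≤ (subst (0ℤ ≤_) (ℤP.pos-* (degree N i) (degree N j)) (ℤ.+≤+ ℕ.z≤n)))

  ∑-innerEdges : ∀ cl → ∑[ c < k ] (+ innerEdges N cl c)
                        ≡ ∑[ i < k ] ∑[ j < k ] (𝟙 (lt i j) * (𝟙 (adj N i j) * 𝟙 (together cl i j)))
  ∑-innerEdges cl = begin
    ∑[ c < k ] (+ innerEdges N cl c)                      ≡⟨ sum-cong-≗ (λ c → countL-pairs (inner c)) ⟩
    ∑[ c < k ] ∑[ i < k ] ∑[ j < k ] 𝟙 (inner c (i , j))  ≡⟨ ∑-push-in (λ c i j → 𝟙 (inner c (i , j))) ⟩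
    ∑[ i < k ] ∑[ j < k ] ∑[ c < k ] 𝟙 (inner c (i , j))  ≡⟨ ∑∑-cong select-cluster ⟩
    ∑[ i < k ] ∑[ j < k ] (𝟙 (lt i j) * (𝟙 (adj N i j) * 𝟙 (together cl i j))) ∎
    where
    open ≡-Reasoning
    inner : Fin k → Fin k × Fin k → Bool
    inner c (i , j) = lt i j ∧ adj N i j ∧ eqF (cl i) c ∧ eqF (cl j) c
    rearrange : ∀ p q r s → p * (q * (r * s)) ≡ r * (p * (q * s))
    rearrange = solve-∀
    𝟙-inner : ∀ i j c → 𝟙 (inner c (i , j))
                        ≡ 𝟙 (eqF (cl i) c) * (𝟙 (lt i j) * (𝟙 (adj N i j) * 𝟙 (eqF (cl j) c)))
    𝟙-inner i j c = begin
      𝟙 (inner c (i , j))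
        ≡⟨ 𝟙-∧ (lt i j) _ ⟩
      𝟙 (lt i j) * 𝟙 (adj N i j ∧ eqF (cl i) c ∧ eqF (cl j) c)
        ≡⟨ cong (𝟙 (lt i j) *_) (𝟙-∧ (adj N i j) _) ⟩
      𝟙 (lt i j) * (𝟙 (adj N i j) * 𝟙 (eqF (cl i) c ∧ eqF (cl j) c))
        ≡⟨ cong (λ x → 𝟙 (lt i j) * (𝟙 (adj N i j) * x)) (𝟙-∧ (eqF (cl i) c) (eqF (cl j) c)) ⟩
      𝟙 (lt i j) * (𝟙 (adj N i j) * (𝟙 (eqF (cl i) c) * 𝟙 (eqF (cl j) c)))
        ≡⟨ rearrange (𝟙 (lt i j)) (𝟙 (adj N i j)) (𝟙 (eqF (cl i) c)) (𝟙 (eqF (cl j) c)) ⟩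
      𝟙 (eqF (cl i) c) * (𝟙 (lt i j) * (𝟙 (adj N i j) * 𝟙 (eqF (cl j) c))) ∎
    select-cluster : ∀ i j → ∑[ c < k ] 𝟙 (inner c (i , j)) ≡ 𝟙 (lt i j) * (𝟙 (adj N i j) * 𝟙 (together cl i j))
    select-cluster i j = begin
      ∑[ c < k ] 𝟙 (inner c (i , j))
        ≡⟨ sum-cong-≗ (𝟙-inner i j) ⟩
      ∑[ c < k ] (𝟙 (eqF (cl i) c) * (𝟙 (lt i j) * (𝟙 (adj N i j) * 𝟙 (eqF (cl j) c))))
        ≡⟨ ∑-select (cl i) (λ c → 𝟙 (lt i j) * (𝟙 (adj N i j) * 𝟙 (eqF (cl j) c))) ⟩
      𝟙 (lt i j) * (𝟙 (adj N i j) * 𝟙 (together cl j i))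
        ≡⟨ cong (λ b → 𝟙 (lt i j) * (𝟙 (adj N i j) * 𝟙 b)) (together-sym cl j i) ⟩
      𝟙 (lt i j) * (𝟙 (adj N i j) * 𝟙 (together cl i j)) ∎

  clusterDegree-∑ : ∀ cl c → + clusterDegree N cl c ≡ ∑[ v < k ] (𝟙 (eqF (cl v) c) * + degree N v)
  clusterDegree-∑ cl c = weightedCount-tabulate (λ v → eqF (cl v) c) (degree N) id

  ∑-clusterDegree² : ∀ cl → ∑[ c < k ] (+ clusterDegree N cl c * + clusterDegree N cl c)
                            ≡ ∑[ u < k ] ∑[ v < k ] (𝟙 (together cl u v) * (+ degree N u * + degree N v))
  ∑-clusterDegree² cl = begin
    ∑[ c < k ] (+ clusterDegree N cl c * + clusterDegree N cl c)
      ≡⟨ sum-cong-≗ (λ c → cong₂ _*_ (clusterDegree-∑ cl c) (clusterDegree-∑ cl c)) ⟩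
    ∑[ c < k ] (sum (f c) * sum (f c))
      ≡⟨ sum-cong-≗ (λ c → ∑-*-∑ (f c) (f c)) ⟩
    ∑[ c < k ] ∑[ u < k ] ∑[ v < k ] (f c u * f c v)
      ≡⟨ ∑-push-in (λ c u v → f c u * f c v) ⟩
    ∑[ u < k ] ∑[ v < k ] ∑[ c < k ] (f c u * f c v)
      ≡⟨ ∑∑-cong select-cluster ⟩
    ∑[ u < k ] ∑[ v < k ] (𝟙 (together cl u v) * (+ degree N u * + degree N v)) ∎
    where
    open ≡-Reasoning
    f : Fin k → Fin k → ℤ
    f c v = 𝟙 (eqF (cl v) c) * + degree N v
    rearrange : ∀ p x q y → p * x * (q * y) ≡ p * (q * (x * y))
    rearrange = solve-∀
    select-cluster : ∀ u v → ∑[ c < k ] (f c u * f c v) ≡ 𝟙 (together cl u v) * (+ degree N u * + degree N v)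
    select-cluster u v = begin
      ∑[ c < k ] (f c u * f c v)
        ≡⟨ sum-cong-≗ (λ c → rearrange (𝟙 (eqF (cl u) c)) (+ degree N u) (𝟙 (eqF (cl v) c)) (+ degree N v)) ⟩
      ∑[ c < k ] (𝟙 (eqF (cl u) c) * (𝟙 (eqF (cl v) c) * (+ degree N u * + degree N v)))
        ≡⟨ ∑-select (cl u) (λ c → 𝟙 (eqF (cl v) c) * (+ degree N u * + degree N v)) ⟩
      𝟙 (together cl v u) * (+ degree N u * + degree N v)
        ≡⟨ cong (λ b → 𝟙 b * (+ degree N u * + degree N v)) (together-sym cl v u) ⟩
      𝟙 (together cl u v) * (+ degree N u * + degree N v) ∎

  ∑-scaledClusterTerm : ∀ cl {M} → numEdges N ≡ M →
    ∑[ c < k ] (+ 4 * + M * + innerEdges N cl c - + clusterDegree N cl c * + clusterDegree N cl c) ≡ score cl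
  ∑-scaledClusterTerm cl refl = begin
    ∑[ c < k ] (4E * e c - d c * d c)
      ≡⟨ ∑-distrib-− (λ c → 4E * e c) (λ c → d c * d c) ⟩
    ∑[ c < k ] (4E * e c) - ∑[ c < k ] (d c * d c)
      ≡⟨ cong₂ _-_ (sym (*-distribˡ-sum 4E e)) (∑-clusterDegree² cl) ⟩
    4E * sum e - D
      ≡⟨ cong (λ x → 4E * x - D) (∑-innerEdges cl) ⟩
    4E * ∑[ i < k ] ∑[ j < k ] (𝟙 (lt i j) * P i j) - D
      ≡⟨ cong (_- D) (regroup (+ numEdges N) _) ⟩
    2E * (+ 2 * ∑[ i < k ] ∑[ j < k ] (𝟙 (lt i j) * P i j)) - D
      ≡⟨ cong (λ x → 2E * x - D) (∑∑-upper-half P P-sym P-diag) ⟩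
    2E * ∑[ i < k ] ∑[ j < k ] P i j - D
      ≡⟨ cong (_- D) (*-distribˡ-∑∑ 2E P) ⟩
    ∑[ i < k ] ∑[ j < k ] (2E * P i j) - D
      ≡⟨ ∑∑-distrib-− (λ i j → 2E * P i j) S·dd ⟨
    ∑[ i < k ] ∑[ j < k ] (2E * P i j - S·dd i j)
      ≡⟨ ∑∑-cong (λ i j → factor 2E (𝟙 (adj N i j)) (𝟙 (together cl i j)) (+ degree N i * + degree N j)) ⟩
    score cl ∎
    where
    open ≡-Reasoning
    2E 4E : ℤ
    2E = + 2 * + numEdges N
    4E = + 4 * + numEdges N
    e d : Fin k → ℤ
    e c = + innerEdges N cl c
    d c = + clusterDegree N cl c
    P S·dd : Fin k → Fin k → ℤ
    P i j = 𝟙 (adj N i j) * 𝟙 (together cl i j)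
    S·dd i j = 𝟙 (together cl i j) * (+ degree N i * + degree N j)
    D : ℤ
    D = ∑[ i < k ] ∑[ j < k ] S·dd i j
    P-sym : ∀ i j → P i j ≡ P j i
    P-sym i j = cong₂ (λ p q → 𝟙 p * 𝟙 q) (Network.sym N i j) (together-sym cl i j)
    P-diag : ∀ i → P i i ≡ 0ℤ
    P-diag i = cong (λ b → 𝟙 b * 𝟙 (together cl i i)) (irrefl N i)
    regroup : ∀ m x → + 4 * m * x ≡ + 2 * m * (+ 2 * x)
    regroup = solve-∀
    factor : ∀ t a s w → t * (a * s) - s * w ≡ s * (t * a - w)
    factor = solve-∀

-- x / 4(m+1)², recalling that mkℚᵘ stores the denominator minus one
over4M² : ℕ → ℤ → ℚᵘ
over4M² m x = mkℚᵘ x (ℕ.pred (4 ℕ.* suc m ℕ.* suc m))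

clusterTerm : ℕ → ℕ → ℕ → ℚ
clusterTerm m e d = (+ e) ℚ./ suc m ℚ.- ((+ d) ℚ./ (2 ℕ.* suc m)) ℚ.* ((+ d) ℚ./ (2 ℕ.* suc m))

modularity-unfold : ∀ {k} (N : Network k) cl {m} → numEdges N ≡ suc m →
  modularity N cl ≡ foldr (λ c s → clusterTerm m (innerEdges N cl c) (clusterDegree N cl c) ℚ.+ s) 0ℚ (allFin k)
modularity-unfold N cl E≡ rewrite E≡ = refl

clusterTerm-≃ : ∀ m e d → ℚ.toℚᵘ (clusterTerm m e d) ≃ over4M² m (+ 4 * + suc m * + e - + d * + d)
clusterTerm-≃ m e d =
  ℚᵘP.≃-trans (ℚP.toℚᵘ-homo-+ e/M (ℚ.- (d/2M ℚ.* d/2M)))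
    (ℚᵘP.≃-trans (ℚᵘP.+-cong (ℚP.toℚᵘ-fromℚᵘ (mkℚᵘ (+ e) m)) d²/4M²-≃)
      (*≡* cross-multiplied))
  where
  e/M d/2M : ℚ
  e/M = (+ e) ℚ./ suc m
  d/2M = (+ d) ℚ./ (2 ℕ.* suc m)
  d/2Mᵘ : ℚᵘ
  d/2Mᵘ = mkℚᵘ (+ d) (ℕ.pred (2 ℕ.* suc m))
  d²/4M²-≃ : ℚ.toℚᵘ (ℚ.- (d/2M ℚ.* d/2M)) ≃ ℚᵘ.- (d/2Mᵘ ℚᵘ.* d/2Mᵘ)
  d²/4M²-≃ = ℚᵘP.≃-trans (ℚP.toℚᵘ-homo‿- (d/2M ℚ.* d/2M))
               (ℚᵘP.-‿cong (ℚᵘP.≃-trans (ℚP.toℚᵘ-homo-* d/2M d/2M)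
                 (ℚᵘP.*-cong (ℚP.toℚᵘ-fromℚᵘ d/2Mᵘ) (ℚP.toℚᵘ-fromℚᵘ d/2Mᵘ))))
  cross-multiplied :
    (+ e * + (2 ℕ.* suc m ℕ.* (2 ℕ.* suc m)) + - (+ d * + d) * + suc m) * + (4 ℕ.* suc m ℕ.* suc m)
    ≡ (+ 4 * + suc m * + e - + d * + d) * + (suc m ℕ.* (2 ℕ.* suc m ℕ.* (2 ℕ.* suc m)))
  cross-multiplied
    rewrite ℤP.pos-* (suc m) (2 ℕ.* suc m ℕ.* (2 ℕ.* suc m)) | ℤP.pos-* (2 ℕ.* suc m) (2 ℕ.* suc m)
          | ℤP.pos-* 2 (suc m) | ℤP.pos-* (4 ℕ.* suc m) (suc m) | ℤP.pos-* 4 (suc m)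
          = identity (+ e) (+ d) (+ suc m)
    where
    identity : ∀ e d M → (e * ((+ 2 * M) * (+ 2 * M)) + - (d * d) * M) * ((+ 4 * M) * M)
                         ≡ (+ 4 * M * e - d * d) * (M * ((+ 2 * M) * (+ 2 * M)))
    identity = solve-∀

mkℚᵘ-+-same : ∀ x y q → mkℚᵘ x q ℚᵘ.+ mkℚᵘ y q ≃ mkℚᵘ (x + y) q
mkℚᵘ-+-same x y q = *≡* (trans (identity x y (+ suc q)) (cong ((x + y) *_) (ℤP.pos-* (suc q) (suc q))))
  where
  identity : ∀ x y z → (x * z + y * z) * z ≡ (x + y) * (z * z)
  identity = solve-∀

toℚᵘ-foldr-+ : ∀ {A : Set} {n} {t : A → ℚ} {x : A → ℤ} {q} → (∀ a → ℚ.toℚᵘ (t a) ≃ mkℚᵘ (x a) q) →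
  (f : Fin n → A) → ℚ.toℚᵘ (foldr (λ a s → t a ℚ.+ s) 0ℚ (tabulate f)) ≃ mkℚᵘ (∑[ i < n ] x (f i)) q
toℚᵘ-foldr-+ {n = zero}              t≃ f = *≡* refl
toℚᵘ-foldr-+ {n = suc n} {t} {x} {q} t≃ f =
  ℚᵘP.≃-trans (ℚP.toℚᵘ-homo-+ (t (f zero)) _)
    (ℚᵘP.≃-trans (ℚᵘP.+-cong (t≃ (f zero)) (toℚᵘ-foldr-+ t≃ (f ∘ suc)))
      (mkℚᵘ-+-same (x (f zero)) (∑[ i < n ] x (f (suc i))) q))

modularity-≃ : ∀ {k} (N : Network k) cl {m} → numEdges N ≡ suc m →
               ℚ.toℚᵘ (modularity N cl) ≃ over4M² m (score N cl)
modularity-≃ N cl {m} E≡ =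
  ℚᵘP.≃-trans (ℚᵘP.≃-reflexive (cong ℚ.toℚᵘ (modularity-unfold N cl E≡)))
    (ℚᵘP.≃-trans (toℚᵘ-foldr-+ (λ c → clusterTerm-≃ m (innerEdges N cl c) (clusterDegree N cl c)) id)
      (ℚᵘP.≃-reflexive (cong (over4M² m) (∑-scaledClusterTerm N cl E≡))))

numerator-mono : ∀ {p q : ℚ} {x y : ℤ} t → ℚ.toℚᵘ p ≃ mkℚᵘ x t → ℚ.toℚᵘ q ≃ mkℚᵘ y t → p ℚ.≤ q → x ≤ y
numerator-mono {x = x} {y} t p≃ q≃ p≤q with ℚᵘP.≤-respʳ-≃ q≃ (ℚᵘP.≤-respˡ-≃ p≃ (ℚP.toℚᵘ-mono-≤ p≤q))
... | *≤* cross≤ = ℤP.*-cancelʳ-≤-pos x y (+ suc t) cross≤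

modularity-≤⇒score-≤ : ∀ {k} (N : Network k) {cl cl′} {m} → numEdges N ≡ suc m →
                        modularity N cl ℚ.≤ modularity N cl′ → score N cl ≤ score N cl′
modularity-≤⇒score-≤ N {cl} {cl′} E≡ = numerator-mono _ (modularity-≃ N cl E≡) (modularity-≃ N cl′ E≡)

-- Two n-cliques joined by a single edge

record BridgedCliques {k} (N : Network k) (A B : Subset k) (n : ℕ) (a b : Fin k) : Set where
  field
    disjoint      : ∀ v → v ∈ A → v ∉ B
    size-A        : ∣ A ∣ ≡ n
    size-B        : ∣ B ∣ ≡ n
    clique-A      : Clique N A
    clique-B      : Clique N B
    a∈A           : a ∈ A
    b∈B           : b ∈ B
    bridge        : Adj N a b
    bridge-unique : ∀ a′ b′ → a′ ∈ A → b′ ∈ B → Adj N a′ b′ → a′ ≡ a × b′ ≡ b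
    isolated      : ∀ u v → u ∈ A ⊎ u ∈ B → ¬ (v ∈ A ⊎ v ∈ B) → ¬ Adj N u v

swapSides : ∀ {k} {N : Network k} {A B n a b} → BridgedCliques N A B n a b → BridgedCliques N B A n b a
swapSides {N = N} G = record
  { disjoint      = λ v v∈B v∈A → disjoint v v∈A v∈B
  ; size-A        = size-B
  ; size-B        = size-A
  ; clique-A      = clique-B
  ; clique-B      = clique-A
  ; a∈A           = b∈B
  ; b∈B           = a∈A
  ; bridge        = trans (Network.sym N _ _) bridge
  ; bridge-unique = λ b′ a′ b′∈B a′∈A b′~a′ →
                      swap (bridge-unique a′ b′ a′∈A b′∈B (trans (Network.sym N a′ b′) b′~a′))
  ; isolated      = λ u v u∈U v∉U → isolated u v (Sum.swap u∈U) (v∉U ∘ Sum.swap)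
  }
  where open BridgedCliques G

module SideDegrees {k} {N : Network k} {A B n a b} (G : BridgedCliques N A B n a b) where
  open BridgedCliques G

  A-B-distinct : ∀ {u v} → u ∈ A → v ∈ B → ¬ u ≡ v
  A-B-distinct {u} u∈A v∈B refl = disjoint u u∈A v∈B

  adj-leaving-A : ∀ {x j} → x ∈ A → j ∉ A → ¬ (x ≡ a × j ≡ b) → adj N x j ≡ false
  adj-leaving-A {x} {j} x∈A j∉A not-bridge with j ∈? B
  ... | yes j∈B = adj-false N (not-bridge ∘ bridge-unique x j x∈A j∈B)
  ... | no  j∉B = adj-false N (isolated x j (inj₁ x∈A) [ j∉A , j∉B ])

  neighbourhood : ∀ {x} → x ∈ A → ∀ j →
                  𝟙 (adj N x j) + 𝟙 (eqF x j) ≡ 𝟙 (does (j ∈? A)) + 𝟙 (eqF b j) * 𝟙 (eqF x a)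
  neighbourhood {x} x∈A j with j ∈? A
  ... | yes j∈A rewrite eqF-≢ (≢-sym (A-B-distinct j∈A b∈B)) with x ≟ j
  ...   | yes refl rewrite irrefl N x = refl
  ...   | no  x≢j  rewrite clique-A x j x∈A j∈A x≢j = refl
  neighbourhood {x} x∈A j | no j∉A rewrite eqF-≢ {x = x} {j} (λ x≡j → j∉A (subst (_∈ A) x≡j x∈A))
    with x ≟ a | b ≟ j
  ... | yes refl | yes refl rewrite bridge = refl
  ... | yes refl | no  b≢j  rewrite adj-leaving-A x∈A j∉A (b≢j ∘ sym ∘ proj₂) = refl
  ... | no  x≢a  | b≟j      rewrite adj-leaving-A x∈A j∉A (x≢a ∘ proj₁) =
    sym (trans (ℤP.+-identityˡ _) (ℤP.*-zeroʳ (𝟙 (does b≟j))))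

  degree-in-A : ∀ {x} → x ∈ A → + degree N x + 1ℤ ≡ + n + 𝟙 (eqF x a)
  degree-in-A {x} x∈A = begin
    + degree N x + 1ℤ
      ≡⟨ cong₂ _+_ (degree-∑ N x) (sym (∑-𝟙-eqF x)) ⟩
    ∑[ j < k ] 𝟙 (adj N x j) + ∑[ j < k ] 𝟙 (eqF x j)
      ≡⟨ ∑-distrib-+ (λ j → 𝟙 (adj N x j)) (λ j → 𝟙 (eqF x j)) ⟨
    ∑[ j < k ] (𝟙 (adj N x j) + 𝟙 (eqF x j))
      ≡⟨ sum-cong-≗ (neighbourhood x∈A) ⟩
    ∑[ j < k ] (𝟙 (does (j ∈? A)) + 𝟙 (eqF b j) * 𝟙 (eqF x a))
      ≡⟨ ∑-distrib-+ (λ j → 𝟙 (does (j ∈? A))) (λ j → 𝟙 (eqF b j) * 𝟙 (eqF x a)) ⟩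
    ∑[ j < k ] 𝟙 (does (j ∈? A)) + ∑[ j < k ] (𝟙 (eqF b j) * 𝟙 (eqF x a))
      ≡⟨ cong₂ _+_ (∑-∈ A) (∑-select b (λ _ → 𝟙 (eqF x a))) ⟩
    + ∣ A ∣ + 𝟙 (eqF x a)
      ≡⟨ cong (λ s → + s + 𝟙 (eqF x a)) size-A ⟩
    + n + 𝟙 (eqF x a) ∎
    where open ≡-Reasoning

  degree-anchor : degree N a ≡ n
  degree-anchor =
    ℕP.+-cancelʳ-≡ 1 _ _ (ℤP.+-injective (trans (degree-in-A a∈A) (cong (λ b → + n + 𝟙 b) (eqF-refl a))))

  degree-other : ∀ {x} → x ∈ A → ¬ x ≡ a → suc (degree N x) ≡ n
  degree-other {x} x∈A x≢a =
    trans (ℕP.+-comm 1 (degree N x))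
          (trans (ℤP.+-injective (trans (degree-in-A x∈A) (cong (λ b → + n + 𝟙 b) (eqF-≢ x≢a))))
                 (ℕP.+-identityʳ n))

  degree≤n : ∀ {x} → x ∈ A → degree N x ℕ.≤ n
  degree≤n {x} x∈A with x ≟ a
  ... | yes refl = ℕP.≤-reflexive degree-anchor
  ... | no  x≢a  = subst (degree N x ℕ.≤_) (degree-other x∈A x≢a) (ℕP.n≤1+n (degree N x))

  pred-n≤degree : ∀ {x} → x ∈ A → ℕ.pred n ℕ.≤ degree N x
  pred-n≤degree {x} x∈A with x ≟ a
  ... | yes refl = subst (ℕ.pred n ℕ.≤_) (sym degree-anchor) ℕP.pred[n]≤n
  ... | no  x≢a  = ℕP.≤-reflexive (cong ℕ.pred (sym (degree-other x∈A x≢a)))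

module Component {k} {N : Network k} {A B n a b} (G : BridgedCliques N A B n a b) where
  open BridgedCliques G
  private
    module SA = SideDegrees G
    module SB = SideDegrees (swapSides G)

  InU : Fin k → Set
  InU v = v ∈ A ⊎ v ∈ B

  data Place (v : Fin k) : Set where
    inA : v ∈ A → Place v
    inB : v ∈ B → Place v
    out : ¬ InU v → Place v

  place : ∀ v → Place v
  place v with v ∈? A | v ∈? B
  ... | yes v∈A | _       = inA v∈A
  ... | no  _   | yes v∈B = inB v∈B
  ... | no  v∉A | no  v∉B = out [ v∉A , v∉B ]

  InU-closed : ∀ {u v} → InU u → Adj N u v → InU v
  InU-closed {v = v} Uu u~v with place v
  ... | inA v∈A = inj₁ v∈A
  ... | inB v∈B = inj₂ v∈B
  ... | out ¬Uv = ⊥-elim (isolated _ v Uu ¬Uv u~v)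

  outside-closed : ∀ {u v} → ¬ InU u → Adj N u v → ¬ InU v
  outside-closed ¬Uu u~v Uv = isolated _ _ Uv ¬Uu (trans (Network.sym N _ _) u~v)

  degree≤n : ∀ {x} → InU x → degree N x ℕ.≤ n
  degree≤n (inj₁ x∈A) = SA.degree≤n x∈A
  degree≤n (inj₂ x∈B) = SB.degree≤n x∈B

  double-pred-n≤degree : ∀ v → (𝟙 (does (v ∈? A)) + 𝟙 (does (v ∈? B))) * + ℕ.pred n ≤ + degree N v
  double-pred-n≤degree v with v ∈? A | v ∈? B
  ... | yes v∈A | yes v∈B = ⊥-elim (disjoint v v∈A v∈B)
  ... | yes v∈A | no  _   = subst (_≤ + degree N v) (sym (ℤP.*-identityˡ _)) (ℤ.+≤+ (SA.pred-n≤degree v∈A))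
  ... | no  _   | yes v∈B = subst (_≤ + degree N v) (sym (ℤP.*-identityˡ _)) (ℤ.+≤+ (SB.pred-n≤degree v∈B))
  ... | no  _   | no  _   = ℤ.+≤+ ℕ.z≤n

  n²<2|E| : 2 < n → + n * + n ℤ.< + 2 * + numEdges N
  n²<2|E| 2<n = begin-strict
    + n * + n
      <⟨ square<double-pred n 2<n ⟩
    (+ n + + n) * + ℕ.pred n
      ≡⟨ cong₂ (λ p q → (+ p + + q) * + ℕ.pred n) size-A size-B ⟨
    (+ ∣ A ∣ + + ∣ B ∣) * + ℕ.pred n
      ≡⟨ cong (_* + ℕ.pred n) (cong₂ _+_ (∑-∈ A) (∑-∈ B)) ⟨
    (sum 𝟙∈A + sum 𝟙∈B) * + ℕ.pred n
      ≡⟨ cong (_* + ℕ.pred n) (∑-distrib-+ 𝟙∈A 𝟙∈B) ⟨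
    ∑[ v < k ] (𝟙∈A v + 𝟙∈B v) * + ℕ.pred n
      ≡⟨ *-distribʳ-sum (+ ℕ.pred n) (λ v → 𝟙∈A v + 𝟙∈B v) ⟩
    ∑[ v < k ] ((𝟙∈A v + 𝟙∈B v) * + ℕ.pred n)
      ≤⟨ ∑-mono-≤ double-pred-n≤degree ⟩
    ∑[ v < k ] (+ degree N v)
      ≡⟨ handshake N ⟨
    + 2 * + numEdges N ∎
    where
    open ℤP.≤-Reasoning
    𝟙∈A 𝟙∈B : Fin k → ℤ
    𝟙∈A v = 𝟙 (does (v ∈? A))
    𝟙∈B v = 𝟙 (does (v ∈? B))

  edges-exist : 2 < n → ∃ λ m → numEdges N ≡ suc m
  edges-exist 2<n with numEdges N | n²<2|E| 2<n
  ... | suc m | _    = m , refl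
  ... | zero  | n²<0 =
    ⊥-elim (ℤP.<-irrefl refl (ℤP.≤-<-trans (subst (0ℤ ≤_) (ℤP.pos-* n n) (ℤ.+≤+ ℕ.z≤n)) n²<0))

  modMatrix-pos-in-U : 2 < n → ∀ {i j} → InU i → InU j → Adj N i j → 0ℤ ℤ.< modMatrix N i j
  modMatrix-pos-in-U 2<n {i} {j} Ui Uj i~j = modMatrix-pos N i~j (ℤP.≤-<-trans dd≤n² (n²<2|E| 2<n))
    where
    dd≤n² : + degree N i * + degree N j ≤ + n * + n
    dd≤n² = subst₂ _≤_ (ℤP.pos-* (degree N i) (degree N j)) (ℤP.pos-* n n)
                       (ℤ.+≤+ (ℕP.*-mono-≤ (degree≤n Ui) (degree≤n Uj)))

-- Improving a clustering that splits a side

module Improvement {k} {N : Network k} {A B n a b} (G : BridgedCliques N A B n a b) (2<n : 2 < n)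
                   {cl : Clustering k} (adm : Admissible N cl) where
  open BridgedCliques G
  open Component G
  private
    module SA = SideDegrees G
    module SB = SideDegrees (swapSides G)

  clusters-in-U : ∀ {u v} → InU u → cl v ≡ cl u → InU v
  clusters-in-U {u} {v} Uu cl-vu = PathIn-stays InU InU-closed (adm u v (sym cl-vu)) Uu

  Improvable : Set
  Improvable = Σ (Clustering k) λ cl′ → Admissible N cl′ × score N cl ℤ.< score N cl′

  module Relabel (ℓA ℓB : Fin k) (ℓA≢ℓB : ¬ ℓA ≡ ℓB)
                 (ℓA-in-U : ∀ {w} → cl w ≡ ℓA → InU w) (ℓB-in-U : ∀ {w} → cl w ≡ ℓB → InU w) where

    relabel : Clustering k
    relabel v with place v
    ... | inA _ = ℓA
    ... | inB _ = ℓB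
    ... | out _ = cl v

    relabel-A : ∀ {v} → v ∈ A → relabel v ≡ ℓA
    relabel-A {v} v∈A with place v
    ... | inA _   = refl
    ... | inB v∈B = ⊥-elim (disjoint v v∈A v∈B)
    ... | out ¬Uv = ⊥-elim (¬Uv (inj₁ v∈A))

    relabel-B : ∀ {v} → v ∈ B → relabel v ≡ ℓB
    relabel-B {v} v∈B with place v
    ... | inA v∈A = ⊥-elim (disjoint v v∈A v∈B)
    ... | inB _   = refl
    ... | out ¬Uv = ⊥-elim (¬Uv (inj₂ v∈B))

    relabel-out : ∀ {v} → ¬ InU v → relabel v ≡ cl v
    relabel-out {v} ¬Uv with place v
    ... | inA v∈A = ⊥-elim (¬Uv (inj₁ v∈A))
    ... | inB v∈B = ⊥-elim (¬Uv (inj₂ v∈B))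
    ... | out _   = refl

    relabel-A≢B : ∀ {u v} → u ∈ A → v ∈ B → ¬ relabel u ≡ relabel v
    relabel-A≢B u∈A v∈B uv = ℓA≢ℓB (trans (sym (relabel-A u∈A)) (trans uv (relabel-B v∈B)))

    relabel-U≢out : ∀ {u v} → InU u → ¬ InU v → ¬ relabel u ≡ relabel v
    relabel-U≢out (inj₁ u∈A) ¬Uv uv =
      ¬Uv (ℓA-in-U (trans (sym (relabel-out ¬Uv)) (trans (sym uv) (relabel-A u∈A))))
    relabel-U≢out (inj₂ u∈B) ¬Uv uv =
      ¬Uv (ℓB-in-U (trans (sym (relabel-out ¬Uv)) (trans (sym uv) (relabel-B u∈B))))

    cl-U≢out : ∀ {u v} → InU u → ¬ InU v → ¬ cl u ≡ cl v
    cl-U≢out Uu ¬Uv uv = ¬Uv (clusters-in-U Uu (sym uv))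

    relabel-admissible : Admissible N relabel
    relabel-admissible u v uv = by-place (place u) (place v)
      where
      by-place : Place u → Place v → PathIn N relabel (relabel u) u v
      by-place (inA u∈A) (inA v∈A) = clique-PathIn relabel clique-A u∈A v∈A uv
      by-place (inB u∈B) (inB v∈B) = clique-PathIn relabel clique-B u∈B v∈B uv
      by-place (inA u∈A) (inB v∈B) = ⊥-elim (relabel-A≢B u∈A v∈B uv)
      by-place (inB u∈B) (inA v∈A) = ⊥-elim (relabel-A≢B v∈A u∈B (sym uv))
      by-place (inA u∈A) (out ¬Uv) = ⊥-elim (relabel-U≢out (inj₁ u∈A) ¬Uv uv)
      by-place (inB u∈B) (out ¬Uv) = ⊥-elim (relabel-U≢out (inj₂ u∈B) ¬Uv uv)
      by-place (out ¬Uu) (inA v∈A) = ⊥-elim (relabel-U≢out (inj₁ v∈A) ¬Uu (sym uv))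
      by-place (out ¬Uu) (inB v∈B) = ⊥-elim (relabel-U≢out (inj₂ v∈B) ¬Uu (sym uv))
      by-place (out ¬Uu) (out ¬Uv) =
        subst (λ c → PathIn N relabel c u v) (sym (relabel-out ¬Uu))
          (PathIn-relabel (λ w → ¬ InU w) outside-closed relabel-out
            (adm u v (trans (sym (relabel-out ¬Uu)) (trans uv (relabel-out ¬Uv)))) ¬Uu)

    gain : Fin k → Fin k → ℤ
    gain i j = (𝟙 (together relabel i j) - 𝟙 (together cl i j)) * modMatrix N i j

    score-relabel : score N relabel ≡ score N cl + ∑[ i < k ] ∑[ j < k ] gain i j
    score-relabel =
      trans (∑∑-cong λ i j → split (𝟙 (together relabel i j)) (𝟙 (together cl i j)) (modMatrix N i j))
            (∑∑-distrib-+ _ gain)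
      where
      split : ∀ s′ s w → s′ * w ≡ s * w + (s′ - s) * w
      split = solve-∀

    gain-sym : ∀ i j → gain i j ≡ gain j i
    gain-sym i j =
      trans (cong₂ (λ s′ s → (𝟙 s′ - 𝟙 s) * modMatrix N i j) (together-sym relabel i j) (together-sym cl i j))
            (cong (λ w → (𝟙 (together relabel j i) - 𝟙 (together cl j i)) * w) (modMatrix-sym N i j))

    gain-joined : ∀ {u v} → relabel u ≡ relabel v → ¬ cl u ≡ cl v → gain u v ≡ modMatrix N u v
    gain-joined {u} {v} same differ =
      trans (cong₂ (λ s′ s → (𝟙 s′ - 𝟙 s) * modMatrix N u v)
                   (together-true relabel {u} {v} same) (together-false cl {u} {v} differ))
            (ℤP.*-identityˡ (modMatrix N u v))

    gain-same-side : ∀ {S i j} → Clique N S → (∀ {v} → v ∈ S → InU v) → i ∈ S → j ∈ S →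
                     relabel i ≡ relabel j → 0ℤ ≤ gain i j
    gain-same-side {S} {i} {j} S-clique S⊆U i∈S j∈S same = change-nonneg relabel cl i j
      (λ _ differ → ℤP.<⇒≤ (modMatrix-pos-in-U 2<n (S⊆U i∈S) (S⊆U j∈S)
                               (S-clique i j i∈S j∈S (differ ∘ cong cl))))
      (λ differ _ → ⊥-elim (differ same))

    gain-across : ∀ {i j} → ¬ relabel i ≡ relabel j → ¬ Adj N i j → 0ℤ ≤ gain i j
    gain-across {i} {j} differ i≁j = change-nonneg relabel cl i j
      (λ same _ → ⊥-elim (differ same)) (λ _ _ → modMatrix-nonpos N i≁j)

    gain-separated : ∀ {i j} → ¬ relabel i ≡ relabel j → ¬ cl i ≡ cl j → 0ℤ ≤ gain i j
    gain-separated {i} {j} differ differ-cl = change-nonneg relabel cl i j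
      (λ same _ → ⊥-elim (differ same)) (λ _ same → ⊥-elim (differ-cl same))

    gain-nonneg : ∀ i j → ¬ (i ≡ a × j ≡ b) → ¬ (i ≡ b × j ≡ a) → 0ℤ ≤ gain i j
    gain-nonneg i j not-ab not-ba = by-place (place i) (place j)
      where
      by-place : Place i → Place j → 0ℤ ≤ gain i j
      by-place (inA i∈A) (inA j∈A) =
        gain-same-side clique-A inj₁ i∈A j∈A (trans (relabel-A i∈A) (sym (relabel-A j∈A)))
      by-place (inB i∈B) (inB j∈B) =
        gain-same-side clique-B inj₂ i∈B j∈B (trans (relabel-B i∈B) (sym (relabel-B j∈B)))
      by-place (inA i∈A) (inB j∈B) =
        gain-across (relabel-A≢B i∈A j∈B) (not-ab ∘ bridge-unique i j i∈A j∈B)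
      by-place (inB i∈B) (inA j∈A) =
        gain-across (relabel-A≢B j∈A i∈B ∘ sym)
                    (not-ba ∘ swap ∘ bridge-unique j i j∈A i∈B ∘ trans (Network.sym N j i))
      by-place (inA i∈A) (out ¬Uj) =
        gain-separated (relabel-U≢out (inj₁ i∈A) ¬Uj) (cl-U≢out (inj₁ i∈A) ¬Uj)
      by-place (inB i∈B) (out ¬Uj) =
        gain-separated (relabel-U≢out (inj₂ i∈B) ¬Uj) (cl-U≢out (inj₂ i∈B) ¬Uj)
      by-place (out ¬Ui) (inA j∈A) =
        gain-separated (relabel-U≢out (inj₁ j∈A) ¬Ui ∘ sym) (cl-U≢out (inj₁ j∈A) ¬Ui ∘ sym)
      by-place (out ¬Ui) (inB j∈B) =
        gain-separated (relabel-U≢out (inj₂ j∈B) ¬Ui ∘ sym) (cl-U≢out (inj₂ j∈B) ¬Ui ∘ sym)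
      by-place (out ¬Ui) (out ¬Uj) = change-nonneg relabel cl i j
        (λ same differ → ⊥-elim (differ (trans (sym (relabel-out ¬Ui)) (trans same (relabel-out ¬Uj)))))
        (λ differ same → ⊥-elim (differ (trans (relabel-out ¬Ui) (trans same (sym (relabel-out ¬Uj))))))

    bridge-weight : ℤ
    bridge-weight = 𝟙 (together cl a b) * modMatrix N a b

    -- Only (a , b) and (b , a) can lose score; compensation refunds that loss, so that every summand of
    -- the compensated gain is nonnegative.
    compensation : Fin k → Fin k → ℤ
    compensation i j = 𝟙 (eqF a i) * (𝟙 (eqF b j) * bridge-weight) + 𝟙 (eqF b i) * (𝟙 (eqF a j) * bridge-weight)

    compensated : Fin k → Fin k → ℤ
    compensated i j = gain i j + compensation i j

    a≢b : ¬ a ≡ b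
    a≢b = SA.A-B-distinct a∈A b∈B

    gain-ab : gain a b ≡ - bridge-weight
    gain-ab = trans (cong (λ s → (𝟙 s - 𝟙 (together cl a b)) * modMatrix N a b)
                          (together-false relabel {a} {b} (relabel-A≢B a∈A b∈B)))
                    (negate (𝟙 (together cl a b)) (modMatrix N a b))
      where
      negate : ∀ s w → (0ℤ - s) * w ≡ - (s * w)
      negate = solve-∀

    compensated-ab : compensated a b ≡ 0ℤ
    compensated-ab =
      trans (cong₂ _+_ gain-ab (cong₂ _+_ (trans (𝟙-eqF-refl-* a _) (𝟙-eqF-refl-* b bridge-weight))
                                          (𝟙-eqF-≢-* (≢-sym a≢b) _)))
            (cancel bridge-weight)
      where
      cancel : ∀ w → - w + (w + 0ℤ) ≡ 0ℤ
      cancel = solve-∀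

    compensated-ba : compensated b a ≡ 0ℤ
    compensated-ba =
      trans (cong₂ _+_ (trans (gain-sym b a) gain-ab)
                       (cong₂ _+_ (𝟙-eqF-≢-* a≢b _) (trans (𝟙-eqF-refl-* b _) (𝟙-eqF-refl-* a bridge-weight))))
            (cancel bridge-weight)
      where
      cancel : ∀ w → - w + (0ℤ + w) ≡ 0ℤ
      cancel = solve-∀

    compensated-nonneg : ∀ i j → 0ℤ ≤ compensated i j
    compensated-nonneg i j with (i ≟ a) ×-dec (j ≟ b) | (i ≟ b) ×-dec (j ≟ a)
    ... | yes (refl , refl) | _                 = ℤP.≤-reflexive (sym compensated-ab)
    ... | no _              | yes (refl , refl) = ℤP.≤-reflexive (sym compensated-ba)
    ... | no not-ab         | no not-ba         =
      ℤP.+-mono-≤ (gain-nonneg i j not-ab not-ba)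
        (ℤP.+-mono-≤ (𝟙-*-nonneg (eqF a i) (𝟙-*-nonneg (eqF b j) weight-nonneg))
                     (𝟙-*-nonneg (eqF b i) (𝟙-*-nonneg (eqF a j) weight-nonneg)))
      where
      weight-nonneg : 0ℤ ≤ bridge-weight
      weight-nonneg =
        𝟙-*-nonneg (together cl a b) (ℤP.<⇒≤ (modMatrix-pos-in-U 2<n (inj₁ a∈A) (inj₂ b∈B) bridge))

    ∑∑-compensated : ∑[ i < k ] ∑[ j < k ] compensated i j
                     ≡ ∑[ i < k ] ∑[ j < k ] gain i j + (bridge-weight + bridge-weight)
    ∑∑-compensated = trans (∑∑-distrib-+ gain compensation)
      (cong (λ x → ∑[ i < k ] ∑[ j < k ] gain i j + x)
        (trans (∑∑-distrib-+ (λ i j → 𝟙 (eqF a i) * (𝟙 (eqF b j) * bridge-weight))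
                             (λ i j → 𝟙 (eqF b i) * (𝟙 (eqF a j) * bridge-weight)))
               (cong₂ _+_ (∑∑-select a b (λ _ _ → bridge-weight)) (∑∑-select b a (λ _ _ → bridge-weight)))))

    gain-bound : ∀ {u} → u ∈ A → ¬ cl u ≡ cl a →
                 modMatrix N u a + modMatrix N u a
                   ≤ ∑[ i < k ] ∑[ j < k ] gain i j + (bridge-weight + bridge-weight)
    gain-bound {u} u∈A cl-u≢a = begin
      modMatrix N u a + modMatrix N u a
        ≡⟨ cong₂ _+_ (gain-joined same cl-u≢a)
                     (trans (gain-joined (sym same) (cl-u≢a ∘ sym)) (modMatrix-sym N a u)) ⟨
      gain u a + gain a u
        ≡⟨ cong₂ _+_ uncompensated-ua uncompensated-au ⟨
      compensated u a + compensated a u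
        ≤⟨ ∑∑-pair-≤ compensated-nonneg a u u≢a ⟩
      ∑[ i < k ] ∑[ j < k ] compensated i j
        ≡⟨ ∑∑-compensated ⟩
      ∑[ i < k ] ∑[ j < k ] gain i j + (bridge-weight + bridge-weight) ∎
      where
      open ℤP.≤-Reasoning
      same : relabel u ≡ relabel a
      same = trans (relabel-A u∈A) (sym (relabel-A a∈A))
      u≢a : ¬ u ≡ a
      u≢a = cl-u≢a ∘ cong cl
      u≢b : ¬ u ≡ b
      u≢b = SA.A-B-distinct u∈A b∈B
      uncompensated-ua : compensated u a ≡ gain u a
      uncompensated-ua =
        trans (cong (λ c → gain u a + c) (cong₂ _+_ (𝟙-eqF-≢-* (≢-sym u≢a) _) (𝟙-eqF-≢-* (≢-sym u≢b) _)))
              (ℤP.+-identityʳ (gain u a))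
      uncompensated-au : compensated a u ≡ gain a u
      uncompensated-au =
        trans (cong (λ c → gain a u + c)
                    (cong₂ _+_ (trans (𝟙-eqF-refl-* a _) (𝟙-eqF-≢-* (≢-sym u≢b) bridge-weight))
                               (𝟙-eqF-≢-* (≢-sym a≢b) _)))
              (ℤP.+-identityʳ (gain a u))

    improvable : 0ℤ ℤ.< ∑[ i < k ] ∑[ j < k ] gain i j → Improvable
    improvable 0<gain = relabel , relabel-admissible , (begin-strict
      score N cl                                   ≡⟨ ℤP.+-identityʳ (score N cl) ⟨
      score N cl + 0ℤ                              <⟨ ℤP.+-monoʳ-< (score N cl) 0<gain ⟩
      score N cl + ∑[ i < k ] ∑[ j < k ] gain i j  ≡⟨ score-relabel ⟨
      score N relabel                              ∎)
      where open ℤP.≤-Reasoning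

  improvable-cut : ¬ cl a ≡ cl b → ∀ {u} → u ∈ A → ¬ cl u ≡ cl a → Improvable
  improvable-cut cl-a≢b {u} u∈A cl-u≢a = improvable (ℤP.<-≤-trans (ℤP.+-mono-< W>0 W>0) bound)
    where
    open Relabel (cl a) (cl b) cl-a≢b (clusters-in-U (inj₁ a∈A)) (clusters-in-U (inj₂ b∈B))
    W>0 : 0ℤ ℤ.< modMatrix N u a
    W>0 = modMatrix-pos-in-U 2<n (inj₁ u∈A) (inj₁ a∈A) (clique-A u a u∈A a∈A (cl-u≢a ∘ cong cl))
    no-weight : ∑[ i < k ] ∑[ j < k ] gain i j + (bridge-weight + bridge-weight) ≡ ∑[ i < k ] ∑[ j < k ] gain i j
    no-weight rewrite together-false cl cl-a≢b = ℤP.+-identityʳ _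
    bound : modMatrix N u a + modMatrix N u a ≤ ∑[ i < k ] ∑[ j < k ] gain i j
    bound = subst (modMatrix N u a + modMatrix N u a ≤_) no-weight (gain-bound u∈A cl-u≢a)

  improvable-kept : cl a ≡ cl b → ∀ {u} → u ∈ A → ¬ cl u ≡ cl a → Improvable
  improvable-kept cl-a≡b {u} u∈A cl-u≢a =
    improvable (ℤP.<-≤-trans (ℤ.+<+ (ℕ.s≤s ℕ.z≤n)) (+-cancelʳ-≤ (W-ab + W-ab) bound))
    where
    open Relabel (cl a) (cl u) (cl-u≢a ∘ sym) (clusters-in-U (inj₁ a∈A)) (clusters-in-U (inj₁ u∈A))
    u≢a : ¬ u ≡ a
    u≢a = cl-u≢a ∘ cong cl
    W-ab : ℤ
    W-ab = modMatrix N a b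
    -- a and b have one more neighbour than u: this is what makes cutting the bridge profitable
    degree-a : degree N a ≡ suc (degree N u)
    degree-a = trans SA.degree-anchor (sym (SA.degree-other u∈A u≢a))
    degree-b : degree N b ≡ suc (degree N u)
    degree-b = trans SB.degree-anchor (sym (SA.degree-other u∈A u≢a))
    excess : modMatrix N u a + modMatrix N u a ≡ + 2 * + suc (degree N u) + (W-ab + W-ab)
    excess rewrite modMatrix-adj N (clique-A u a u∈A a∈A u≢a) | modMatrix-adj N bridge | degree-a | degree-b
      = identity (+ 2 * + numEdges N) (+ degree N u)
      where
      identity : ∀ T d → T - d * (1ℤ + d) + (T - d * (1ℤ + d))
                         ≡ + 2 * (1ℤ + d) + (T - (1ℤ + d) * (1ℤ + d) + (T - (1ℤ + d) * (1ℤ + d)))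
      identity = solve-∀
    full-weight : bridge-weight ≡ W-ab
    full-weight rewrite together-true cl cl-a≡b = ℤP.*-identityˡ W-ab
    bound : + 2 * + suc (degree N u) + (W-ab + W-ab) ≤ ∑[ i < k ] ∑[ j < k ] gain i j + (W-ab + W-ab)
    bound = subst₂ _≤_ excess (cong (λ w → ∑[ i < k ] ∑[ j < k ] gain i j + (w + w)) full-weight)
                   (gain-bound u∈A cl-u≢a)

  not-improvable : (∀ cl′ → Admissible N cl′ → modularity N cl′ ℚ.≤ modularity N cl) → ¬ Improvable
  not-improvable optimal (cl′ , adm′ , score<score′) with edges-exist 2<n
  ... | m , E≡ = ℤP.<-irrefl refl (ℤP.<-≤-trans score<score′ (modularity-≤⇒score-≤ N E≡ (optimal cl′ adm′)))

  cluster-of-a-covers-A : (∀ cl′ → Admissible N cl′ → modularity N cl′ ℚ.≤ modularity N cl) →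
                          ∀ {u} → u ∈ A → cl u ≡ cl a
  cluster-of-a-covers-A optimal {u} u∈A with cl u ≟ cl a | cl a ≟ cl b
  ... | yes cl-u≡a | _          = cl-u≡a
  ... | no  cl-u≢a | yes cl-a≡b = ⊥-elim (not-improvable optimal (improvable-kept cl-a≡b u∈A cl-u≢a))
  ... | no  cl-u≢a | no  cl-a≢b = ⊥-elim (not-improvable optimal (improvable-cut cl-a≢b u∈A cl-u≢a))

module OptimalClustering {k} {N : Network k} {A B n a b} (G : BridgedCliques N A B n a b) (2<n : 2 < n)
                         {cl : Clustering k} (opt : ModularityOptimal N cl) where
  open BridgedCliques G
  open Improvement G 2<n (proj₁ opt) using (clusters-in-U; cluster-of-a-covers-A)
  private
    module Swapped = Improvement (swapSides G) 2<n (proj₁ opt)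

  A-in-cluster-of-a : ∀ {v} → v ∈ A → cl v ≡ cl a
  A-in-cluster-of-a = cluster-of-a-covers-A (proj₂ opt)

  B-in-cluster-of-b : ∀ {v} → v ∈ B → cl v ≡ cl b
  B-in-cluster-of-b = Swapped.cluster-of-a-covers-A (proj₂ opt)

  bridge-kept : cl a ≡ cl b → IsCluster cl (A ∪ B)
  bridge-kept cl-a≡b = (a , x∈p∪q⁺ (inj₁ a∈A)) , cl a , λ v →
    (x∈p∪q⁺ ∘ clusters-in-U (inj₁ a∈A)) ,
    [ A-in-cluster-of-a , (λ v∈B → trans (B-in-cluster-of-b v∈B) (sym cl-a≡b)) ] ∘ x∈p∪q⁻ A B

  bridge-cut : ¬ cl a ≡ cl b → IsCluster cl A × IsCluster cl B
  bridge-cut cl-a≢b = ((a , a∈A) , cl a , λ v → cluster-a⊆A , A-in-cluster-of-a)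
                    , ((b , b∈B) , cl b , λ v → cluster-b⊆B , B-in-cluster-of-b)
    where
    cluster-a⊆A : ∀ {v} → cl v ≡ cl a → v ∈ A
    cluster-a⊆A {v} cl-va with clusters-in-U (inj₁ a∈A) cl-va
    ... | inj₁ v∈A = v∈A
    ... | inj₂ v∈B = ⊥-elim (cl-a≢b (trans (sym cl-va) (B-in-cluster-of-b v∈B)))
    cluster-b⊆B : ∀ {v} → cl v ≡ cl b → v ∈ B
    cluster-b⊆B {v} cl-vb with clusters-in-U (inj₂ b∈B) cl-vb
    ... | inj₂ v∈B = v∈B
    ... | inj₁ v∈A = ⊥-elim (cl-a≢b (trans (sym (A-in-cluster-of-a v∈A)) cl-vb))

  clusters : IsCluster cl (A ∪ B) ⊎ (IsCluster cl A × IsCluster cl B)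
  clusters with cl a ≟ cl b
  ... | yes cl-a≡b = inj₁ (bridge-kept cl-a≡b)
  ... | no  cl-a≢b = inj₂ (bridge-cut cl-a≢b)

lemma7 : ∀ {k} (N : Network k) (A B : Subset k) (n : ℕ) →
    (∀ v → v ∈ A → v ∉ B) →
    ∣ A ∣ ≡ n → ∣ B ∣ ≡ n → 5 < n →
    Clique N A → Clique N B →
    (∃ λ a → ∃ λ b → a ∈ A × b ∈ B × Adj N a b ×
      (∀ a′ b′ → a′ ∈ A → b′ ∈ B → Adj N a′ b′ → a′ ≡ a × b′ ≡ b)) →
    (∀ u v → u ∈ A ∪ B → v ∉ A ∪ B → ¬ Adj N u v) →
    ∀ (cl : Clustering k) → ModularityOptimal N cl →
    IsCluster cl (A ∪ B) ⊎ (IsCluster cl A × IsCluster cl B)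
lemma7 N A B n disjoint size-A size-B 5<n clique-A clique-B (a , b , a∈A , b∈B , bridge , bridge-unique)
       isolated cl opt = OptimalClustering.clusters G (ℕP.≤-trans (ℕP.m≤m+n 3 3) 5<n) opt
  where
  G : BridgedCliques N A B n a b
  G = record
    { disjoint      = disjoint
    ; size-A        = size-A
    ; size-B        = size-B
    ; clique-A      = clique-A
    ; clique-B      = clique-B
    ; a∈A           = a∈A
    ; b∈B           = b∈B
    ; bridge        = bridge
    ; bridge-unique = bridge-unique
    ; isolated      = λ u v u∈U v∉U → isolated u v (x∈p∪q⁺ u∈U) (v∉U ∘ x∈p∪q⁻ A B)
    }
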